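{- Let $d$ be a positive integer and let $G$ be a graph of girth $g$ and minimum degree at least $6(d+1)$. Then for every nonempty $X\subset V(G)$ with $|X|\le \frac13 d^{\lfloor (g-1)/2\rfloor}$, we have $|\partial X|>2|X|$.
   Context: For $X\subset V(G)$, $\partial X=\{y\in V(G)\setminus X : \exists x\in X,\ \{x,y\}\in E(G)\}$ is the open neighborhood of $X$. The girth of $G$ is the length of a shortest cycle in $G$. -}

module Defs where

open import Data.Nat using (ℕ; zero; suc; _≤_; _<_)
open import Data.Bool using (Bool; true; false; not; _∧_)
open import Data.Fin using (Fin; toℕ)
open import Data.Fin.Subset using (Subset; ∣_∣; _∈_)
open import Data.Vec using (tabulate; lookup)
open import Data.Bool.ListAction using () renaming (any to anyL)
open import Data.List using (allFin)
open import Data.Product using (Σ; _×_)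
open import Data.Sum using (_⊎_)
open import Function.Definitions using (Injective)
open import Relation.Binary.PropositionalEquality using (_≡_; _≢_)

record Graph (n : ℕ) : Set where
  field
    adj       : Fin n → Fin n → Bool
    adj-sym   : ∀ x y → adj x y ≡ adj y x
    adj-irref : ∀ x → adj x x ≡ false
open Graph public

∂ : ∀ {n} → Graph n → Subset n → Subset n
∂ {n} G X = tabulate λ y → not (lookup X y) ∧ anyL (λ x → lookup X x ∧ adj G x y) (allFin n)

nbhd : ∀ {n} → Graph n → Fin n → Subset n
nbhd G v = tabulate (adj G v)

degree : ∀ {n} → Graph n → Fin n → ℕ
degree G v = ∣ nbhd G v ∣

MinDegreeAtLeast : ∀ {n} → Graph n → ℕ → Set
MinDegreeAtLeast G δ = ∀ v → δ ≤ degree G v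

IsCycle : ∀ {n} → Graph n → (k : ℕ) → (Fin k → Fin n) → Set
IsCycle G k c =
  3 ≤ k × Injective _≡_ _≡_ c ×
  (∀ i j → (suc (toℕ i) ≡ toℕ j ⊎ (suc (toℕ i) ≡ k × toℕ j ≡ 0)) →
     adj G (c i) (c j) ≡ true)

HasCycleOfLength : ∀ {n} → Graph n → ℕ → Set
HasCycleOfLength {n} G k = Σ (Fin k → Fin n) (IsCycle G k)

HasGirth : ∀ {n} → Graph n → ℕ → Set
HasGirth G g = HasCycleOfLength G g × (∀ k → HasCycleOfLength G k → g ≤ k)

module Submission where

-- Suppose X is nonempty, 3|X| ≤ d^r with r = ⌊(g-1)/2⌋, and |∂X| ≤ 2|X|.
-- Every neighbour of a vertex of X lies in Y = X ∪ ∂X, and |Y| ≤ 3|X|, so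
-- the degree sum inside Y is at least 6(d+1)|X| > 2d|Y|: the induced
-- subgraph on Y has average degree above 2d.  Repeatedly deleting vertices
-- of inside-degree ≤ d never destroys this inequality, so it stops at a
-- nonempty core T ⊆ Y in which every vertex has at least d+1 neighbours.
-- The non-backtracking walks of length r inside T starting from a fixed
-- vertex are at least (d+1)d^(r-1) many, and, as 2r < g, two of them with
-- the same final vertex would close up to a cycle shorter than g.  Hence
-- (d+1)d^(r-1) ≤ |T| ≤ |Y| ≤ 3|X| ≤ d^r, which is absurd.

open import Defs
open import Data.Nat using (ℕ; zero; suc; _≤_; _<_; _*_; _+_; _^_; _∸_; ⌊_/2⌋; NonZero; z≤n; s≤s; z<s; _≤?_; _<?_)
open import Data.Nat.Properties hiding (_≟_)
open import Data.Nat.Induction using (<-rec)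
open import Data.Nat.Solver using (module +-*-Solver)
open import Algebra.Properties.Semiring.Sum +-*-semiring using (sum; sum-cong-≗; sum-replicate-zero; ∑-distrib-+; *-distribʳ-sum)
open import Data.Bool using (Bool; true; false; not; _∧_; _∨_; if_then_else_; T) renaming (_≟_ to _≟ᵇ_)
open import Data.Bool.Properties using (¬-not; T-≡)
open import Data.Bool.ListAction using () renaming (any to anyL)
open import Data.Fin using (Fin; zero; suc; toℕ)
open import Data.Fin.Properties using (_≟_; any?; toℕ-injective; toℕ<n)
import Data.Fin.Properties as Fin
open import Data.Fin.Subset using (Subset; ∣_∣; Nonempty)
open import Data.Vec using ([]; _∷_; lookup)
open import Data.Vec.Properties using (lookup∘tabulate; []=⇒lookup)
open import Data.List using (List; []; _∷_; length; map; concatMap; allFin)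
open import Data.List.Properties using (length-++; length-map; ∷-injectiveˡ; ∷-injectiveʳ)
open import Data.List.Membership.Propositional.Properties using (∈-allFin; ∈-map⁻)
open import Data.List.Relation.Unary.All as All using (All; []; _∷_)
import Data.List.Relation.Unary.All.Properties as All
open import Data.List.Relation.Unary.AllPairs as AllPairs using ([]; _∷_)
import Data.List.Relation.Unary.AllPairs.Properties as AllPairs
import Data.List.Relation.Unary.Any as Any
open import Data.List.Relation.Unary.Any.Properties using (any⁺)
open import Function.Bundles using (Equivalence)
open import Data.List.Relation.Unary.Unique.Propositional using (Unique)
open import Data.List.Relation.Binary.Disjoint.Propositional using (Disjoint)
import Data.List.Relation.Unary.Unique.Propositional.Properties as Unique
open import Data.Product using (∃-syntax; _×_; _,_; proj₁; proj₂)
open import Data.Sum using (_⊎_; inj₁; inj₂)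
open import Data.Empty using (⊥-elim)
open import Function using (_∘_; id)
open import Relation.Binary using (tri<; tri≈; tri>; DecidableEquality)
open import Relation.Binary.PropositionalEquality
open import Relation.Nullary using (¬_; Dec; yes; no; does)
open import Relation.Nullary.Decidable using (dec-false; _×-dec_)

-- Vertex sets as characteristic functions; these are what the counting
-- arguments manipulate (a `Subset n` is converted by `lookup`).
VSet : ℕ → Set
VSet n = Fin n → Bool

_⊆ᵥ_ : ∀ {n} → VSet n → VSet n → Set
S ⊆ᵥ T = ∀ u → S u ≡ true → T u ≡ true

_─_ : ∀ {n} → VSet n → Fin n → VSet n
(S ─ v) u = if does (u ≟ v) then false else S u

─-⊆ : ∀ {n} (S : VSet n) v → (S ─ v) ⊆ᵥ S
─-⊆ S v u with does (u ≟ v)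
... | true  = λ ()
... | false = id

─-removes : ∀ {n} (S : VSet n) {v u} → (S ─ v) u ≡ true → u ≢ v
─-removes S {v} {u} u∈S─v with u ≟ v | u∈S─v
... | yes _   | ()
... | no  u≢v | _ = u≢v

─-keeps : ∀ {n} (S : VSet n) {v u} → v ≢ u → S u ≡ true → (S ─ v) u ≡ true
─-keeps S {v} {u} v≢u Su rewrite dec-false (u ≟ v) (v≢u ∘ sym) = Su

ind : Bool → ℕ
ind true  = 1
ind false = 0

ind-mono : ∀ {a b} → (a ≡ true → b ≡ true) → ind a ≤ ind b
ind-mono {false} _   = z≤n
ind-mono {true}  a⇒b rewrite a⇒b refl = ≤-refl

ind-∨ : ∀ a b → ind (a ∨ b) ≤ ind a + ind b
ind-∨ true  b = s≤s z≤n
ind-∨ false b = ≤-refl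

ind-∧ : ∀ a b → ind (a ∧ b) ≡ ind a * ind b
ind-∧ true  b = sym (+-identityʳ (ind b))
ind-∧ false b = refl

ind≤1 : ∀ a → ind a ≤ 1
ind≤1 true  = ≤-refl
ind≤1 false = z≤n

count : ∀ {n} → VSet n → ℕ
count S = sum (λ u → ind (S u))

sum-mono : ∀ {n} {f g : Fin n → ℕ} → (∀ i → f i ≤ g i) → sum f ≤ sum g
sum-mono {zero}  _   = z≤n
sum-mono {suc n} f≤g = +-mono-≤ (f≤g zero) (sum-mono (f≤g ∘ suc))

sum-point : ∀ {n} (f : Fin n → ℕ) i → f i ≤ sum f
sum-point f zero    = m≤m+n (f zero) _
sum-point f (suc i) = ≤-trans (sum-point (f ∘ suc) i) (m≤n+m _ (f zero))

sum-split : ∀ {n} (f : Fin n → ℕ) v →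
  sum f ≡ sum (λ u → if does (u ≟ v) then 0 else f u) + f v
sum-split f zero    = +-comm (f zero) _
sum-split f (suc v) = trans (cong (f zero +_) (sum-split (f ∘ suc) v)) (sym (+-assoc (f zero) _ _))

sum-─ : ∀ {n} (F : Fin n → Bool → ℕ) → (∀ u → F u false ≡ 0) → ∀ (S : VSet n) v →
  sum (λ u → F u (S u)) ≡ sum (λ u → F u ((S ─ v) u)) + F v (S v)
sum-─ F F0 S v = trans (sum-split _ v) (cong (_+ F v (S v)) (sum-cong-≗ dropped))
  where
  dropped : ∀ u → (if does (u ≟ v) then 0 else F u (S u)) ≡ F u ((S ─ v) u)
  dropped u with does (u ≟ v)
  ... | true  = sym (F0 u)
  ... | false = refl

count-─ : ∀ {n} (S : VSet n) v → count S ≡ count (S ─ v) + ind (S v)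
count-─ = sum-─ (λ _ → ind) (λ _ → refl)

count-mono : ∀ {n} {S T : VSet n} → S ⊆ᵥ T → count S ≤ count T
count-mono S⊆T = sum-mono (λ u → ind-mono (S⊆T u))

count-∨ : ∀ {n} (S T : VSet n) → count (λ u → S u ∨ T u) ≤ count S + count T
count-∨ S T = ≤-trans (sum-mono (λ u → ind-∨ (S u) (T u)))
                      (≤-reflexive (∑-distrib-+ (λ u → ind (S u)) (λ u → ind (T u))))

count-∈ : ∀ {n} (S : VSet n) {v} → S v ≡ true → 1 ≤ count S
count-∈ S {v} Sv = subst (λ b → ind b ≤ count S) Sv (sum-point _ v)

count≤n : ∀ {n} (S : VSet n) → count S ≤ n
count≤n {zero}  S = z≤n
count≤n {suc n} S = +-mono-≤ (ind≤1 (S zero)) (count≤n (S ∘ suc))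

∣∣≡count : ∀ {n} (X : Subset n) → ∣ X ∣ ≡ count (lookup X)
∣∣≡count []           = refl
∣∣≡count (true  ∷ X) = cong suc (∣∣≡count X)
∣∣≡count (false ∷ X) = ∣∣≡count X

unique⇒length≤count : ∀ {n} (S : VSet n) {xs} → Unique xs →
  All (λ x → S x ≡ true) xs → length xs ≤ count S
unique⇒length≤count S []              []          = z≤n
unique⇒length≤count S {x ∷ xs} (x∉xs ∷ uniq) (Sx ∷ Sxs) = begin
  suc (length xs)    ≤⟨ s≤s (unique⇒length≤count (S ─ x) uniq rest) ⟩
  suc (count (S ─ x)) ≡⟨ +-comm 1 _ ⟩
  count (S ─ x) + 1  ≡⟨ cong (λ b → count (S ─ x) + ind b) Sx ⟨
  count (S ─ x) + ind (S x) ≡⟨ count-─ S x ⟨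
  count S            ∎
  where
  open ≤-Reasoning
  rest : All (λ y → (S ─ x) y ≡ true) xs
  rest = All.zipWith (λ (x≢y , Sy) → ─-keeps S x≢y Sy) (x∉xs , Sxs)

length-concatMap : ∀ {A B : Set} (f : A → List B) {K} (xs : List A) →
  All (λ x → K ≤ length (f x)) xs → K * length xs ≤ length (concatMap f xs)
length-concatMap f {K} []       []       = ≤-reflexive (*-zeroʳ K)
length-concatMap f {K} (x ∷ xs) (p ∷ ps) = begin
  K * suc (length xs)                  ≡⟨ *-suc K (length xs) ⟩
  K + K * length xs                    ≤⟨ +-mono-≤ p (length-concatMap f xs ps) ⟩
  length (f x) + length (concatMap f xs) ≡⟨ length-++ (f x) ⟨
  length (concatMap f (x ∷ xs))        ∎
  where open ≤-Reasoning

prependZeroIf : ∀ {n} → Bool → List (Fin (suc n)) → List (Fin (suc n))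
prependZeroIf true  xs = zero ∷ xs
prependZeroIf false xs = xs

members : ∀ {n} → VSet n → List (Fin n)
members {zero}  S = []
members {suc n} S = prependZeroIf (S zero) (map suc (members (S ∘ suc)))

members-length : ∀ {n} (S : VSet n) → length (members S) ≡ count S
members-length {zero}  S = refl
members-length {suc n} S with S zero
... | true  = cong suc (trans (length-map suc (members (S ∘ suc))) (members-length (S ∘ suc)))
... | false = trans (length-map suc (members (S ∘ suc))) (members-length (S ∘ suc))

members-⊆ : ∀ {n} (S : VSet n) → All (λ c → S c ≡ true) (members S)
members-⊆ {zero}  S = []
members-⊆ {suc n} S with S zero in S0
... | true  = S0 ∷ All.map⁺ (members-⊆ (S ∘ suc))
... | false = All.map⁺ (members-⊆ (S ∘ suc))

members-unique : ∀ {n} (S : VSet n) → Unique (members S)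
members-unique {zero}  S = []
members-unique {suc n} S with S zero
... | true  = All.map⁺ (All.tabulate (λ _ → Fin.0≢1+n))
            ∷ Unique.map⁺ Fin.suc-injective (members-unique (S ∘ suc))
... | false = Unique.map⁺ Fin.suc-injective (members-unique (S ∘ suc))

∸-unfold : ∀ t k → suc k ≤ t → t ∸ k ≡ suc (t ∸ suc k)
∸-unfold (suc t) zero    _         = refl
∸-unfold (suc t) (suc k) (s≤s k<t) = ∸-unfold t k k<t

lastDisagreement : ∀ {A : Set} (f g : ℕ → A) → DecidableEquality A →
  ∀ {p} t → p ≤ t → f p ≢ g p → f t ≡ g t →
  ∃[ m ] m < t × f m ≢ g m × f (suc m) ≡ g (suc m)
lastDisagreement f g _≟ᴬ_ zero    z≤n fp≢gp ft≡gt = ⊥-elim (fp≢gp ft≡gt)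
lastDisagreement f g _≟ᴬ_ (suc t) p≤t fp≢gp ft≡gt with f t ≟ᴬ g t
... | no  ft≢gt  = t , ≤-refl , ft≢gt , ft≡gt
... | yes ft≡gt′ with m≤n⇒m<n∨m≡n p≤t
...   | inj₂ refl = ⊥-elim (fp≢gp ft≡gt)
...   | inj₁ p<1+t =
  let (m , m<t , rest) = lastDisagreement f g _≟ᴬ_ t (≤-pred p<1+t) fp≢gp ft≡gt′
  in m , ≤-trans m<t (n≤1+n t) , rest

module Walks {n : ℕ} (G : Graph n) where

  Adj : Fin n → Fin n → Set
  Adj x y = adj G x y ≡ true

  Adj-sym : ∀ {x y} → Adj x y → Adj y x
  Adj-sym {x} {y} = trans (adj-sym G y x)

  Adj-irrefl : ∀ {x y} → x ≡ y → ¬ Adj x y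
  Adj-irrefl {x} refl a with trans (sym a) (adj-irref G x)
  ... | ()

  record NBWalk (t : ℕ) (w : ℕ → Fin n) : Set where
    constructor mkWalk
    field
      step     : ∀ k → k < t → Adj (w k) (w (suc k))
      noReturn : ∀ k → 2 + k ≤ t → w k ≢ w (2 + k)
  open NBWalk public

  segment : ∀ {t w} i s → i + s ≤ t → NBWalk t w → NBWalk s (λ k → w (i + k))
  segment {t} {w} i s i+s≤t W = mkWalk stepₛ noReturnₛ
    where
    inside : ∀ {k} → k ≤ s → i + k ≤ t
    inside k≤s = ≤-trans (+-monoʳ-≤ i k≤s) i+s≤t
    stepₛ : ∀ k → k < s → Adj (w (i + k)) (w (i + suc k))
    stepₛ k k<s = subst (λ j → Adj (w (i + k)) (w j)) (sym (+-suc i k))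
      (step W (i + k) (subst (_≤ t) (+-suc i k) (inside k<s)))
    noReturnₛ : ∀ k → 2 + k ≤ s → w (i + k) ≢ w (i + (2 + k))
    noReturnₛ k 2+k≤s = subst (λ j → w (i + k) ≢ w j) (sym i+2+k)
      (noReturn W (i + k) (subst (_≤ t) i+2+k (inside 2+k≤s)))
      where
      i+2+k : i + (2 + k) ≡ 2 + (i + k)
      i+2+k = trans (+-suc i (suc k)) (cong suc (+-suc i k))

  reverseWalk : ∀ {t w} → NBWalk t w → NBWalk t (λ k → w (t ∸ k))
  reverseWalk {t} {w} W = mkWalk stepᵣ noReturnᵣ
    where
    stepᵣ : ∀ k → k < t → Adj (w (t ∸ k)) (w (t ∸ suc k))
    stepᵣ k k<t = subst (λ j → Adj (w j) (w (t ∸ suc k))) (sym t∸k)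
      (Adj-sym (step W (t ∸ suc k) (subst (_≤ t) t∸k (m∸n≤m t k))))
      where
      t∸k : t ∸ k ≡ suc (t ∸ suc k)
      t∸k = ∸-unfold t k k<t
    noReturnᵣ : ∀ k → 2 + k ≤ t → w (t ∸ k) ≢ w (t ∸ (2 + k))
    noReturnᵣ k 2+k≤t = subst (λ j → w j ≢ w (t ∸ (2 + k))) (sym t∸k)
      (λ e → noReturn W (t ∸ (2 + k)) (subst (_≤ t) t∸k (m∸n≤m t k)) (sym e))
      where
      t∸k : t ∸ k ≡ 2 + (t ∸ (2 + k))
      t∸k = trans (∸-unfold t k (≤-trans (n≤1+n _) 2+k≤t)) (cong suc (∸-unfold t (suc k) 2+k≤t))

  join : ℕ → (ℕ → Fin n) → (ℕ → Fin n) → ℕ → Fin n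
  join s f h k with k ≤? s
  ... | yes _ = f k
  ... | no  _ = h (k ∸ s)

  join-left : ∀ s f h {k} → k ≤ s → join s f h k ≡ f k
  join-left s f h {k} k≤s with k ≤? s
  ... | yes _   = refl
  ... | no  k≰s = ⊥-elim (k≰s k≤s)

  join-right : ∀ s f h → f s ≡ h 0 → ∀ j → join s f h (s + j) ≡ h j
  join-right s f h fs≡h0 zero = trans (cong (join s f h) (+-identityʳ s))
                                      (trans (join-left s f h ≤-refl) fs≡h0)
  join-right s f h _ (suc j) with s + suc j ≤? s
  ... | yes s+1+j≤s = ⊥-elim (<-irrefl refl (≤-trans (m<m+n s z<s) s+1+j≤s))
  ... | no  _       = cong h (m+n∸m≡n s (suc j))

  joinWalk : ∀ {s t f h} → NBWalk (suc s) f → NBWalk (suc t) h →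
    f (suc s) ≡ h 0 → f s ≢ h 1 → NBWalk (suc s + suc t) (join (suc s) f h)
  joinWalk {s} {t} {f} {h} F H meet turn = mkWalk stepⱼ noReturnⱼ
    where
    S : ℕ
    S = suc s
    right : ∀ j → join S f h (S + j) ≡ h j
    right = join-right S f h meet
    beyond : ∀ {k} → S ≤ k → k ≡ S + (k ∸ S)
    beyond S≤k = sym (m+[n∸m]≡n S≤k)
    stepⱼ : ∀ k → k < S + suc t → Adj (join S f h k) (join S f h (suc k))
    stepⱼ k k< = bySide (k <? S)
      where
      bySide : Dec (k < S) → Adj (join S f h k) (join S f h (suc k))
      bySide (yes k<S) = subst₂ Adj (sym (join-left S f h (<⇒≤ k<S))) (sym (join-left S f h k<S)) (step F k k<S)
      bySide (no  k≮S) = subst₂ Adj (sym (trans (cong (join S f h) k≡) (right j)))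
                                    (sym (trans (cong (join S f h) (trans (cong suc k≡) (sym (+-suc S j)))) (right (suc j))))
                                    (step H j (+-cancelˡ-< S j (suc t) (subst (_< S + suc t) k≡ k<)))
        where
        j : ℕ
        j = k ∸ S
        k≡ : k ≡ S + j
        k≡ = beyond (≮⇒≥ k≮S)
    noReturnⱼ : ∀ k → 2 + k ≤ S + suc t → join S f h k ≢ join S f h (2 + k)
    noReturnⱼ k k+2≤ with <-cmp k s
    ... | tri< k<s _ _ = subst₂ _≢_ (sym (join-left S f h (≤-trans (<⇒≤ k<s) (n≤1+n s))))
                                    (sym (join-left S f h (s≤s k<s))) (noReturn F k (s≤s k<s))
    ... | tri≈ _ refl _ = subst₂ _≢_ (sym (join-left S f h (n≤1+n s)))
                                     (sym (trans (cong (join S f h ∘ suc) (+-comm 1 s)) (right 1))) turn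
    ... | tri> _ _ s<k = subst₂ _≢_ (sym (trans (cong (join S f h) k≡) (right j)))
                                    (sym (trans (cong (join S f h) 2+k≡) (right (2 + j))))
                                    (noReturn H j (+-cancelˡ-≤ S (2 + j) (suc t) (subst (_≤ S + suc t) 2+k≡ k+2≤)))
      where
      j : ℕ
      j = k ∸ S
      k≡ : k ≡ S + j
      k≡ = beyond s<k
      2+k≡ : 2 + k ≡ S + (2 + j)
      2+k≡ = trans (cong (2 +_) k≡) (sym (trans (+-suc S (suc j)) (cong suc (+-suc S j))))

  ShortCycle : ℕ → Set
  ShortCycle L = ∃[ k ] k ≤ L × HasCycleOfLength G k

  Closed : ℕ → (ℕ → Fin n) → Set
  Closed L w = 1 ≤ L × w 0 ≡ w L

  closed⇒3≤length : ∀ {L w} → Closed L w → NBWalk L w → 3 ≤ L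
  closed⇒3≤length {1} (_ , w0≡w1) W = ⊥-elim (Adj-irrefl w0≡w1 (step W 0 ≤-refl))
  closed⇒3≤length {2} (_ , w0≡w2) W = ⊥-elim (noReturn W 0 ≤-refl w0≡w2)
  closed⇒3≤length {suc (suc (suc _))} _ _ = s≤s (s≤s (s≤s z≤n))

  simpleClosed⇒cycle : ∀ {L w} → Closed L w → NBWalk L w →
    (∀ (i j : Fin L) → toℕ i < toℕ j → w (toℕ i) ≢ w (toℕ j)) → HasCycleOfLength G L
  simpleClosed⇒cycle {L} {w} C W distinct = c , closed⇒3≤length C W , c-injective , c-adjacent
    where
    c : Fin L → Fin n
    c i = w (toℕ i)
    c-injective : ∀ {i j} → c i ≡ c j → i ≡ j
    c-injective {i} {j} ci≡cj with <-cmp (toℕ i) (toℕ j)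
    ... | tri< i<j _ _ = ⊥-elim (distinct i j i<j ci≡cj)
    ... | tri≈ _ i≡j _ = toℕ-injective i≡j
    ... | tri> _ _ j<i = ⊥-elim (distinct j i j<i (sym ci≡cj))
    c-adjacent : ∀ i j → (suc (toℕ i) ≡ toℕ j ⊎ (suc (toℕ i) ≡ L × toℕ j ≡ 0)) → Adj (c i) (c j)
    c-adjacent i j (inj₁ next) = subst (Adj (c i) ∘ w) next (step W (toℕ i) (toℕ<n i))
    c-adjacent i j (inj₂ (last , first)) = subst (Adj (c i)) wrap (step W (toℕ i) (toℕ<n i))
      where
      wrap : w (suc (toℕ i)) ≡ c j
      wrap = trans (cong w last) (trans (sym (proj₂ C)) (cong w (sym first)))

  -- Every closed non-backtracking walk of length L contains a cycle of
  -- length ≤ L: cut out the part between two visits of a repeated vertex,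
  -- which is a shorter closed non-backtracking walk.
  closedWalk⇒cycle : ∀ L w → Closed L w → NBWalk L w → ShortCycle L
  closedWalk⇒cycle = <-rec _ shorten
    where
    shorten : ∀ L → (∀ {L′} → L′ < L → ∀ w → Closed L′ w → NBWalk L′ w → ShortCycle L′) →
      ∀ w → Closed L w → NBWalk L w → ShortCycle L
    shorten L shorter w C W
      with any? (λ (i : Fin L) → any? (λ (j : Fin L) → (toℕ i <? toℕ j) ×-dec (w (toℕ i) ≟ w (toℕ j))))
    ... | no noRepeat = L , ≤-refl , simpleClosed⇒cycle C W (λ i j i<j e → noRepeat (i , j , i<j , e))
    ... | yes (i , j , i<j , wi≡wj) =
      let (k , k≤L′ , cycle) = shorter L′<L (λ k → w (toℕ i + k)) closedPart
                                         (segment (toℕ i) L′ i+L′≤L W)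
      in k , ≤-trans k≤L′ (<⇒≤ L′<L) , cycle
      where
      L′ : ℕ
      L′ = toℕ j ∸ toℕ i
      i+L′≡j : toℕ i + L′ ≡ toℕ j
      i+L′≡j = m+[n∸m]≡n (<⇒≤ i<j)
      i+L′≤L : toℕ i + L′ ≤ L
      i+L′≤L = subst (_≤ L) (sym i+L′≡j) (<⇒≤ (toℕ<n j))
      L′<L : L′ < L
      L′<L = ≤-<-trans (m∸n≤m (toℕ j) (toℕ i)) (toℕ<n j)
      closedPart : Closed L′ (λ k → w (toℕ i + k))
      closedPart = m<n⇒0<n∸m i<j , trans (cong w (+-identityʳ (toℕ i))) (trans wi≡wj (cong w (sym i+L′≡j)))

  -- Two non-backtracking walks of length t with the same start and the
  -- same end that differ somewhere: follow the first up to the point where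
  -- they last reunite and return along the second.  This closed walk does
  -- not backtrack, so it contains a cycle of length ≤ 2t.
  divergingWalks⇒cycle : ∀ {t f g} → NBWalk t f → NBWalk t g → f 0 ≡ g 0 → f t ≡ g t →
    ∀ {p} → p ≤ t → f p ≢ g p → ShortCycle (t + t)
  divergingWalks⇒cycle {t} {f} {g} Wf Wg f0≡g0 ft≡gt p≤t fp≢gp
    with lastDisagreement f g _≟_ t p≤t fp≢gp ft≡gt
  ... | m , m<t , fm≢gm , reunite =
    let (k , k≤2M , cycle) = closedWalk⇒cycle (M + M) loop closed loopWalk
    in k , ≤-trans k≤2M (+-mono-≤ m<t m<t) , cycle
    where
    M : ℕ
    M = suc m
    back : ℕ → Fin n
    back k = g (M ∸ k)
    loop : ℕ → Fin n
    loop = join M f back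
    loopWalk : NBWalk (M + M) loop
    loopWalk = joinWalk (segment 0 M m<t Wf) (reverseWalk (segment 0 M m<t Wg)) reunite fm≢gm
    closed : Closed (M + M) loop
    closed = s≤s z≤n , (begin
      loop 0         ≡⟨ join-left M f back z≤n ⟩
      f 0            ≡⟨ f0≡g0 ⟩
      g 0            ≡⟨ cong g (n∸n≡0 M) ⟨
      back M         ≡⟨ join-right M f back reunite M ⟨
      loop (M + M)   ∎)
      where open ≡-Reasoning

∧-true : ∀ {a b} → a ∧ b ≡ true → a ≡ true × b ≡ true
∧-true {true} {true} _ = refl , refl

nbrsIn : ∀ {n} → Graph n → VSet n → Fin n → VSet n
nbrsIn G S u w = S w ∧ adj G u w

degIn : ∀ {n} → Graph n → VSet n → Fin n → ℕ
degIn G S u = count (nbrsIn G S u)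

MinDegreeIn : ∀ {n} → Graph n → VSet n → ℕ → Set
MinDegreeIn G S δ = ∀ u → S u ≡ true → δ ≤ degIn G S u

-- Walks are
-- lists of vertices, newest first, so `vertexAt w` reads a walk of length
-- t backwards from its newest vertex (time 0) to v (time t).
module WalksInto {n : ℕ} (G : Graph n) (T : VSet n) {d : ℕ}
                 (minDeg : MinDegreeIn G T (suc d)) {v : Fin n} (v∈T : T v ≡ true) where

  open Walks G

  vertexAt : List (Fin n) → ℕ → Fin n
  vertexAt []       _       = v
  vertexAt (x ∷ _)  zero    = x
  vertexAt (_ ∷ xs) (suc k) = vertexAt xs k

  nextVertices : List (Fin n) → VSet n
  nextVertices []          = λ _ → false
  nextVertices (a ∷ [])    = nbrsIn G T a
  nextVertices (a ∷ b ∷ _) = nbrsIn G T a ─ b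

  extensions : List (Fin n) → List (List (Fin n))
  extensions w = map (_∷ w) (members (nextVertices w))

  walksOf : ℕ → List (List (Fin n))
  walksOf zero    = (v ∷ []) ∷ []
  walksOf (suc t) = concatMap extensions (walksOf t)

  record Valid (t : ℕ) (w : List (Fin n)) : Set where
    field
      len    : length w ≡ suc t
      start  : vertexAt w t ≡ v
      headIn : T (vertexAt w 0) ≡ true
      walk   : NBWalk t (vertexAt w)
  open Valid

  consWalk : ∀ {t w c} → NBWalk t (vertexAt w) → Adj c (vertexAt w 0) →
    (1 ≤ t → c ≢ vertexAt w 1) → NBWalk (suc t) (vertexAt (c ∷ w))
  consWalk W c~w₀ c≢w₁ = mkWalk
    (λ { zero _ → c~w₀ ; (suc k) (s≤s k<t) → step W k k<t })
    (λ { zero (s≤s 1≤t) → c≢w₁ 1≤t ; (suc k) (s≤s 2+k≤t) → noReturn W k 2+k≤t })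

  valid-extension : ∀ {t w c} → Valid t w → nextVertices w c ≡ true → Valid (suc t) (c ∷ w)
  valid-extension {t} {a ∷ []} {c} V c∈ = record
    { len = cong suc (len V) ; start = start V ; headIn = proj₁ (∧-true c∈)
    ; walk = consWalk (walk V) (Adj-sym (proj₂ (∧-true c∈))) t≢0 }
    where
    t≢0 : 1 ≤ t → c ≢ v
    t≢0 1≤t = ⊥-elim (<⇒≢ 1≤t (suc-injective (len V)))
  valid-extension {t} {a ∷ b ∷ _} {c} V c∈ = record
    { len = cong suc (len V) ; start = start V ; headIn = proj₁ (∧-true c∈N)
    ; walk = consWalk (walk V) (Adj-sym (proj₂ (∧-true c∈N))) (λ _ → ─-removes (nbrsIn G T a) c∈) }
    where
    c∈N : nbrsIn G T a c ≡ true
    c∈N = ─-⊆ (nbrsIn G T a) b c c∈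

  valid-walks : ∀ t → All (Valid t) (walksOf t)
  valid-walks zero    = record { len = refl ; start = refl ; headIn = v∈T ; walk = mkWalk (λ _ ()) (λ _ ()) } ∷ []
  valid-walks (suc t) = All.concat⁺ (All.map⁺ (All.map valid-extensions (valid-walks t)))
    where
    valid-extensions : ∀ {w} → Valid t w → All (Valid (suc t)) (extensions w)
    valid-extensions V = All.map⁺ (All.map (valid-extension V) (members-⊆ _))

  unique-walks : ∀ t → Unique (walksOf t)
  unique-walks zero    = [] ∷ []
  unique-walks (suc t) = Unique.concat⁺ (All.map⁺ (All.tabulate (λ _ → unique-extensions)))
                                         (AllPairs.map⁺ (AllPairs.map disjoint (unique-walks t)))
    where
    unique-extensions : ∀ {w} → Unique (extensions w)
    unique-extensions = Unique.map⁺ ∷-injectiveˡ (members-unique _)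
    disjoint : ∀ {w w′} → w ≢ w′ → Disjoint (extensions w) (extensions w′)
    disjoint {w} {w′} w≢w′ (x∈ , x∈′) with ∈-map⁻ (_∷ w) x∈ | ∈-map⁻ (_∷ w′) x∈′
    ... | _ , _ , refl | _ , _ , x≡ = w≢w′ (∷-injectiveʳ x≡)

  -- A walk of positive length has at least d extensions: its newest vertex
  -- has at least d+1 neighbours in T, one of which is excluded.
  extensions-length : ∀ {t w} → Valid (suc t) w → d ≤ length (extensions w)
  extensions-length {t} {a ∷ b ∷ _} V = ≤-pred (begin
    suc d                            ≤⟨ minDeg a (headIn V) ⟩
    count N                          ≡⟨ count-─ N b ⟩
    count (N ─ b) + ind (N b)        ≤⟨ +-monoʳ-≤ _ (ind≤1 (N b)) ⟩
    count (N ─ b) + 1                ≡⟨ +-comm _ 1 ⟩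
    suc (count (N ─ b))              ≡⟨ cong suc (members-length (N ─ b)) ⟨
    suc (length (members (N ─ b)))   ≡⟨ cong suc (length-map _ (members (N ─ b))) ⟨
    suc (length (extensions (a ∷ b ∷ _))) ∎)
    where
    open ≤-Reasoning
    N : VSet n
    N = nbrsIn G T a
  extensions-length {t} {[]} V = ⊥-elim (0≢1+n (len V))
  extensions-length {t} {_ ∷ []} V = ⊥-elim (0≢1+n (suc-injective (len V)))

  walks-length : ∀ t → suc d * d ^ t ≤ length (walksOf (suc t))
  walks-length zero = begin
    suc d * 1                        ≡⟨ *-identityʳ (suc d) ⟩
    suc d                            ≤⟨ minDeg v v∈T ⟩
    count (nbrsIn G T v)             ≡⟨ members-length (nbrsIn G T v) ⟨
    length (members (nbrsIn G T v))  ≡⟨ length-map _ (members (nbrsIn G T v)) ⟨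
    length (extensions (v ∷ []))     ≡⟨ +-identityʳ _ ⟨
    length (extensions (v ∷ [])) + 0 ≡⟨ length-++ (extensions (v ∷ [])) ⟨
    length (walksOf 1)               ∎
    where open ≤-Reasoning
  walks-length (suc t) = begin
    suc d * (d * d ^ t)              ≡⟨ solve 2 (λ d x → (con 1 :+ d) :* (d :* x) := d :* ((con 1 :+ d) :* x))
                                                refl d (d ^ t) ⟩
    d * (suc d * d ^ t)              ≤⟨ *-monoʳ-≤ d (walks-length t) ⟩
    d * length (walksOf (suc t))     ≤⟨ length-concatMap extensions (walksOf (suc t))
                                          (All.map extensions-length (valid-walks (suc t))) ⟩
    length (walksOf (suc (suc t)))   ∎
    where
    open ≤-Reasoning
    open +-*-Solver

  firstDifference : ∀ (w w′ : List (Fin n)) → length w ≡ length w′ → w ≢ w′ →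
    ∃[ p ] p < length w × vertexAt w p ≢ vertexAt w′ p
  firstDifference []      []        _   w≢w′ = ⊥-elim (w≢w′ refl)
  firstDifference (x ∷ w) (x′ ∷ w′) len≡ w≢w′ with x ≟ x′
  ... | no  x≢x′ = 0 , s≤s z≤n , x≢x′
  ... | yes refl =
    let (p , p< , differ) = firstDifference w w′ (suc-injective len≡) (w≢w′ ∘ cong (x ∷_))
    in suc p , s≤s p< , differ

  -- If 2r is below the girth, different walks of length r have different
  -- newest vertices: otherwise they would close up to a short cycle.
  module _ {g : ℕ} (girth≤ : ∀ k → HasCycleOfLength G k → g ≤ k) {r : ℕ} (2r<g : r + r < g) where

    distinct-heads : ∀ {w w′} → Valid r w → Valid r w′ → w ≢ w′ → vertexAt w 0 ≢ vertexAt w′ 0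
    distinct-heads {w} {w′} V V′ w≢w′ same-head =
      let (p , p<len , differ) = firstDifference w w′ (trans (len V) (sym (len V′))) w≢w′
          (k , k≤2r , cycle) = divergingWalks⇒cycle (walk V) (walk V′) same-head
                                 (trans (start V) (sym (start V′))) (≤-pred (subst (p <_) (len V) p<len)) differ
      in <⇒≱ 2r<g (≤-trans (girth≤ k cycle) k≤2r)

    -- Hence the newest vertices of the walks of length r are distinct,
    -- they lie in T, and there are at most |T| walks of length r.
    unique-heads : ∀ {ws} → Unique ws → All (Valid r) ws → Unique (map (λ w → vertexAt w 0) ws)
    unique-heads []                []       = []
    unique-heads (w∉ws ∷ uniq) (V ∷ Vs) =
      All.map⁺ (All.zipWith (λ (w≢w′ , V′) → distinct-heads V V′ w≢w′) (w∉ws , Vs))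
      ∷ unique-heads uniq Vs

    walks-fit : length (walksOf r) ≤ count T
    walks-fit = subst (_≤ count T) (length-map _ (walksOf r))
      (unique⇒length≤count T (unique-heads (unique-walks r) (valid-walks r))
                               (All.map⁺ (All.map headIn (valid-walks r))))

mooreBound : ∀ {n} (G : Graph n) {g} → (∀ k → HasCycleOfLength G k → g ≤ k) →
  ∀ {d} (T : VSet n) → MinDegreeIn G T (suc d) → ∀ {v} → T v ≡ true →
  ∀ t → suc t + suc t < g → suc d * d ^ t ≤ count T
mooreBound G girth≤ T minDeg v∈T t 2r<g = ≤-trans (walks-length t) (walks-fit girth≤ {r = suc t} 2r<g)
  where open WalksInto G T minDeg v∈T

degreeSum : ∀ {n} → Graph n → VSet n → ℕ
degreeSum G S = sum (λ u → ind (S u) * degIn G S u)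

ind*≤ : ∀ b x → ind b * x ≤ x
ind*≤ true  x = ≤-reflexive (+-identityʳ x)
ind*≤ false x = z≤n

module Peeling {n : ℕ} (G : Graph n) (d : ℕ) where

  degIn-─ : ∀ S v u → degIn G S u ≡ degIn G (S ─ v) u + ind (S v ∧ adj G u v)
  degIn-─ S v u = sum-─ (λ w b → ind (b ∧ adj G u w)) (λ _ → refl) S v

  -- Deleting a vertex of inside-degree ≤ d lowers the degree sum by at most
  -- 2d: v loses its own degree, and each neighbour of v loses one.
  peelStep : ∀ S v → degIn G S v ≤ d → degreeSum G S ≤ degreeSum G (S ─ v) + d + d
  peelStep S v low = begin
    degreeSum G S
      ≡⟨ sum-cong-≗ (λ u → trans (cong (ind (S u) *_) (degIn-─ S v u)) (*-distribˡ-+ (ind (S u)) _ _)) ⟩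
    sum (λ u → ind (S u) * degIn G (S ─ v) u + ind (S u) * toV u)
      ≡⟨ ∑-distrib-+ (λ u → ind (S u) * degIn G (S ─ v) u) (λ u → ind (S u) * toV u) ⟩
    sum (λ u → ind (S u) * degIn G (S ─ v) u) + sum (λ u → ind (S u) * toV u)
      ≡⟨ cong (_+ sum (λ u → ind (S u) * toV u))
              (sum-─ (λ u b → ind b * degIn G (S ─ v) u) (λ _ → refl) S v) ⟩
    degreeSum G (S ─ v) + ind (S v) * degIn G (S ─ v) v + sum (λ u → ind (S u) * toV u)
      ≤⟨ +-mono-≤ (+-monoʳ-≤ (degreeSum G (S ─ v)) lostAt-v) lostElsewhere ⟩
    degreeSum G (S ─ v) + d + d ∎
    where
    open ≤-Reasoning
    toV : Fin n → ℕ
    toV u = ind (S v ∧ adj G u v)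
    lostAt-v : ind (S v) * degIn G (S ─ v) v ≤ d
    lostAt-v = ≤-trans (ind*≤ (S v) _)
                 (≤-trans (count-mono (λ w w∈ → cong₂ _∧_ (─-⊆ S v w (proj₁ (∧-true w∈)))
                                                         (proj₂ (∧-true w∈))))
                          low)
    lostElsewhere : sum (λ u → ind (S u) * toV u) ≤ d
    lostElsewhere = ≤-trans (sum-mono (λ u → ≤-trans (≤-reflexive (sym (ind-∧ (S u) _))) (ind-mono edgeToV))) low
      where
      edgeToV : ∀ {u} → S u ∧ (S v ∧ adj G u v) ≡ true → nbrsIn G S v u ≡ true
      edgeToV {u} e = let (Su , rest) = ∧-true e
                      in cong₂ _∧_ Su (trans (adj-sym G v u) (proj₂ (∧-true rest)))

  degreeSum-empty : ∀ S → (∀ u → S u ≡ false) → degreeSum G S ≡ 0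
  degreeSum-empty S empty =
    trans (sum-cong-≗ (λ u → cong (λ b → ind b * degIn G S u) (empty u))) (sum-replicate-zero n)

  record Core (S : VSet n) : Set where
    field
      vertices : VSet n
      ⊆S       : vertices ⊆ᵥ S
      root     : Fin n
      root∈    : vertices root ≡ true
      minDeg   : MinDegreeIn G vertices (suc d)

  enlarge : ∀ {S S′} → S ⊆ᵥ S′ → Core S → Core S′
  enlarge S⊆S′ C = record { vertices = vertices ; ⊆S = λ u → S⊆S′ u ∘ ⊆S u
                          ; root = root ; root∈ = root∈ ; minDeg = minDeg }
    where open Core C

  -- If the average degree of S exceeds 2d, deleting vertices of degree ≤ d
  -- one at a time keeps it above 2d, so the process ends in a core.  The
  -- bound N ≥ |S| limits the number of deletions.
  peel : ∀ N (S : VSet n) → count S ≤ N → (d + d) * count S < degreeSum G S → Core S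
  peel N S count≤N dense with any? (λ u → (S u ≟ᵇ true) ×-dec (degIn G S u ≤? d))
  peel zero S count≤0 dense | yes (v , v∈S , _) = ⊥-elim (<⇒≱ (count-∈ S v∈S) count≤0)
  peel (suc N) S count≤N dense | yes (v , v∈S , low) =
    enlarge (─-⊆ S v) (peel N (S ─ v) (≤-pred (subst (_≤ suc N) countS count≤N)) stillDense)
    where
    countS : count S ≡ suc (count (S ─ v))
    countS = trans (count-─ S v) (trans (cong (λ b → count (S ─ v) + ind b) v∈S) (+-comm _ 1))
    stillDense : (d + d) * count (S ─ v) < degreeSum G (S ─ v)
    stillDense = +-cancelʳ-< (d + d) _ _ (begin-strict
      (d + d) * count (S ─ v) + (d + d)  ≡⟨ trans (+-comm _ (d + d)) (sym (*-suc (d + d) _)) ⟩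
      (d + d) * suc (count (S ─ v))      ≡⟨ cong ((d + d) *_) countS ⟨
      (d + d) * count S                  <⟨ dense ⟩
      degreeSum G S                      ≤⟨ peelStep S v low ⟩
      degreeSum G (S ─ v) + d + d        ≡⟨ +-assoc _ d d ⟩
      degreeSum G (S ─ v) + (d + d)      ∎)
      where open ≤-Reasoning
  ... | no allHigh with any? (λ u → S u ≟ᵇ true)
  ...   | yes (v , v∈S) = record { vertices = S ; ⊆S = λ _ → id ; root = v ; root∈ = v∈S
                                 ; minDeg = λ u u∈S → ≰⇒> (λ low → allHigh (u , u∈S , low)) }
  ...   | no  empty     = ⊥-elim (<⇒≱ dense (≤-trans (≤-reflexive sum≡0) z≤n))
    where
    sum≡0 : degreeSum G S ≡ 0
    sum≡0 = degreeSum-empty S (λ u → ¬-not (λ Su → empty (u , Su)))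

dense⇒large : ∀ {n} (G : Graph n) {g} → (∀ k → HasCycleOfLength G k → g ≤ k) →
  ∀ d (Y : VSet n) → (d + d) * count Y < degreeSum G Y →
  ∀ t → suc t + suc t < g → suc d * d ^ t ≤ count Y
dense⇒large {n} G girth≤ d Y dense t 2r<g =
  ≤-trans (mooreBound G girth≤ vertices minDeg root∈ t 2r<g) (count-mono ⊆S)
  where
  open Peeling G d using (Core; peel)
  open Core (peel n Y (count≤n Y) dense)

degree≡count : ∀ {n} (G : Graph n) u → degree G u ≡ count (adj G u)
degree≡count G u = trans (∣∣≡count (nbhd G u)) (sum-cong-≗ (λ w → cong ind (lookup∘tabulate (adj G u) w)))

degreeSum-≥ : ∀ {n} (G : Graph n) {δ} → MinDegreeAtLeast G δ → (X Y : VSet n) → X ⊆ᵥ Y →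
  (∀ u w → X u ≡ true → adj G u w ≡ true → Y w ≡ true) → count X * δ ≤ degreeSum G Y
degreeSum-≥ G {δ} minDeg X Y X⊆Y nbrs∈Y = begin
  count X * δ                ≡⟨ *-distribʳ-sum δ (λ u → ind (X u)) ⟩
  sum (λ u → ind (X u) * δ)  ≤⟨ sum-mono termwise ⟩
  degreeSum G Y              ∎
  where
  open ≤-Reasoning
  termwise : ∀ u → ind (X u) * δ ≤ ind (Y u) * degIn G Y u
  termwise u with X u in Xu
  ... | false = z≤n
  ... | true rewrite X⊆Y u Xu = +-monoˡ-≤ 0 (begin
    δ                   ≤⟨ minDeg u ⟩
    degree G u          ≡⟨ degree≡count G u ⟩
    count (adj G u)     ≤⟨ count-mono (λ w uw → cong₂ _∧_ (nbrs∈Y u w Xu uw) uw) ⟩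
    degIn G Y u         ∎)

module Hull {n : ℕ} (G : Graph n) (X : Subset n) where

  hull : VSet n
  hull u = lookup X u ∨ lookup (∂ G X) u

  X⊆hull : lookup X ⊆ᵥ hull
  X⊆hull u Xu rewrite Xu = refl

  nbr∈hull : ∀ u w → lookup X u ≡ true → adj G u w ≡ true → hull w ≡ true
  nbr∈hull u w Xu uw with lookup X w in Xw
  ... | true  = refl
  ... | false = begin
    lookup (∂ G X) w                                 ≡⟨ lookup∘tabulate _ w ⟩
    not (lookup X w) ∧ anyL fromX (allFin n)         ≡⟨ cong (λ b → not b ∧ anyL fromX (allFin n)) Xw ⟩
    anyL fromX (allFin n)                            ≡⟨ Equivalence.to T-≡ (any⁺ fromX witness) ⟩
    true                                             ∎
    where
    open ≡-Reasoning
    fromX : Fin n → Bool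
    fromX x = lookup X x ∧ adj G x w
    u-witness : ∀ {x} → u ≡ x → T (fromX x)
    u-witness refl = Equivalence.from T-≡ (cong₂ _∧_ Xu uw)
    witness : Any.Any (T ∘ fromX) (allFin n)
    witness = Any.map u-witness (∈-allFin u)

  hull-size : ∣ ∂ G X ∣ ≤ 2 * ∣ X ∣ → count hull ≤ 3 * ∣ X ∣
  hull-size small∂ = begin
    count hull                               ≤⟨ count-∨ (lookup X) (lookup (∂ G X)) ⟩
    count (lookup X) + count (lookup (∂ G X)) ≡⟨ cong₂ _+_ (∣∣≡count X) (∣∣≡count (∂ G X)) ⟨
    ∣ X ∣ + ∣ ∂ G X ∣                        ≤⟨ +-monoʳ-≤ ∣ X ∣ small∂ ⟩
    3 * ∣ X ∣                                ∎
    where open ≤-Reasoning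

  hull-degreeSum : ∀ {δ} → MinDegreeAtLeast G δ → ∣ X ∣ * δ ≤ degreeSum G hull
  hull-degreeSum minDeg = subst (λ c → c * _ ≤ degreeSum G hull) (sym (∣∣≡count X))
    (degreeSum-≥ G minDeg (lookup X) hull X⊆hull nbr∈hull)

average-gap : ∀ d c → 1 ≤ c → (d + d) * (3 * c) < c * (6 * (d + 1))
average-gap d c 1≤c = begin-strict
  (d + d) * (3 * c)          <⟨ m<m+n _ (≤-trans 1≤c (m≤n*m c 6)) ⟩
  (d + d) * (3 * c) + 6 * c  ≡⟨ solve 2 (λ d c → (d :+ d) :* (con 3 :* c) :+ con 6 :* c
                                                 := c :* (con 6 :* (d :+ con 1))) refl d c ⟩
  c * (6 * (d + 1))          ∎
  where
  open ≤-Reasoning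
  open +-*-Solver

radius : ∀ g → 3 ≤ g → ∃[ t ] ⌊ g ∸ 1 /2⌋ ≡ suc t × suc t + suc t < g
radius (suc (suc (suc m))) _ = t , refl , s≤s (s≤s (≤-trans (≤-reflexive (+-suc t t)) (s≤s 2t≤m)))
  where
  t : ℕ
  t = ⌊ m /2⌋
  2t≤m : t + t ≤ m
  2t≤m = ≤-trans (+-monoʳ-≤ t (⌊n/2⌋≤⌈n/2⌉ m)) (≤-reflexive (⌊n/2⌋+⌈n/2⌉≡n m))
radius 1 (s≤s ())
radius 2 (s≤s (s≤s ()))

-- If |∂X| ≤ 2|X|, the hull X ∪ ∂X has at most 3|X| vertices
-- and degree sum at least 6(d+1)|X|, so it is dense; being dense, it has
-- at least (d+1)d^t vertices, where r = t+1 = ⌊(g-1)/2⌋; but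
-- 3|X| ≤ d^r = d·d^t < (d+1)d^t.
lemma2p1 : (d : ℕ) → .{{_ : NonZero d}} → (n : ℕ) → (G : Graph n) → (g : ℕ) →
    HasGirth G g → MinDegreeAtLeast G (6 * (d + 1)) →
    (X : Subset n) → Nonempty X → 3 * ∣ X ∣ ≤ d ^ ⌊ g ∸ 1 /2⌋ →
    2 * ∣ X ∣ < ∣ ∂ G X ∣
lemma2p1 d n G g (cycle , girth≤) minDeg X (x , x∈X) 3|X|≤d^r with 2 * ∣ X ∣ <? ∣ ∂ G X ∣
... | yes expands = expands
... | no ¬expands with radius g (proj₁ (proj₂ cycle))
...   | t , r≡1+t , 2r<g = ⊥-elim (<⇒≱ (m<n+m (d * d ^ t) (m^n>0 d t)) (begin
  suc d * d ^ t      ≤⟨ dense⇒large G girth≤ d hull dense t 2r<g ⟩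
  count hull         ≤⟨ small ⟩
  3 * ∣ X ∣          ≤⟨ subst (λ r → 3 * ∣ X ∣ ≤ d ^ r) r≡1+t 3|X|≤d^r ⟩
  d * d ^ t          ∎))
  where
  open Hull G X
  open ≤-Reasoning
  small : count hull ≤ 3 * ∣ X ∣
  small = hull-size (≮⇒≥ ¬expands)
  |X|≥1 : 1 ≤ ∣ X ∣
  |X|≥1 = subst (1 ≤_) (sym (∣∣≡count X)) (count-∈ (lookup X) ([]=⇒lookup x∈X))
  dense : (d + d) * count hull < degreeSum G hull
  dense = begin-strict
    (d + d) * count hull   ≤⟨ *-monoʳ-≤ (d + d) small ⟩
    (d + d) * (3 * ∣ X ∣)  <⟨ average-gap d ∣ X ∣ |X|≥1 ⟩
    ∣ X ∣ * (6 * (d + 1))  ≤⟨ hull-degreeSum minDeg ⟩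
    degreeSum G hull       ∎
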